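{- Let $G=(V,E)$ be a finite simple undirected graph and let $x\in V$ be a node with $\deg(x)=2$ that lies on some cycle of $G$. Then for any minimum fill-in ordering $\tau$ of the elimination graph $G_x$, the ordering of $G$ that eliminates $x$ first and then the remaining nodes in the order $\tau$ is a minimum fill-in ordering of $G$.
   Context: The deficiency of $v$ in $G$ is $D_G(v)=\{\{c,d\}: c,d\in\Gamma_G(v),\ c\neq d,\ \{c,d\}\notin E\}$, where $\Gamma_G(v)$ is the neighborhood of $v$. Eliminating $v$ gives $G_v=(V\setminus\{v\},\,E(V\setminus\{v\})\cup D_G(v))$, where $E(U)$ denotes the edges with both endpoints in $U$. A node ordering of $G$ with $n=|V|$ is a bijection $\sigma:\{1,\dots,n\}\to V$; it defines $G^{(0)}=G$, $G^{(i)}=(G^{(i-1)})_{\sigma(i)}$, and has fill-in $\phi(G,\sigma)=\sum_{i=1}^n|D_{G^{(i-1)}}(\sigma(i))|$. $\Phi(G)=\min_\sigma\phi(G,\sigma)$, and $\sigma$ is a minimum fill-in ordering if $\phi(G,\sigma)=\Phi(G)$. -}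

module Defs where

open import Data.Nat using (ℕ; _+_; _≤_)
open import Data.Bool using (Bool; true; false; _∧_; _∨_; not; if_then_else_)
open import Data.Fin using (Fin; _≟_; _<?_)
open import Data.List using (List; []; _∷_; _++_; map; allFin; length)
open import Data.Nat.ListAction using (sum)
open import Data.List.Relation.Unary.Unique.Propositional using (Unique)
open import Data.List.Relation.Unary.Linked using (Linked)
open import Data.List.Membership.Propositional using (_∈_)
open import Data.Product using (Σ; _×_)
open import Data.Empty using (⊥)
open import Relation.Nullary.Decidable using (⌊_⌋)
open import Relation.Binary.PropositionalEquality using (_≡_)

-- A graph whose vertex set is a subset V of Fin n, with adjacency A.
-- The edge set is E = { {u,v} : u,v ∈ V, A u v = true }.
record Graph (n : ℕ) : Set where
  field
    V : Fin n → Bool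
    A : Fin n → Fin n → Bool
open Graph public

SimpleGraph : ∀ {n} → Graph n → Set
SimpleGraph G = (∀ u v → A G u v ≡ A G v u) × (∀ u → A G u u ≡ false)

eqb : ∀ {n} → Fin n → Fin n → Bool
eqb u v = ⌊ u ≟ v ⌋

Edge : ∀ {n} → Graph n → Fin n → Fin n → Bool
Edge G u v = V G u ∧ V G v ∧ A G u v

nbr : ∀ {n} → Graph n → Fin n → Fin n → Bool
nbr G v u = Edge G v u

countFin : ∀ {n} → (Fin n → Bool) → ℕ
countFin {n} p = sum (map (λ i → if p i then 1 else 0) (allFin n))

deg : ∀ {n} → Graph n → Fin n → ℕ
deg G v = countFin (nbr G v)

inDef : ∀ {n} → Graph n → Fin n → Fin n → Fin n → Bool
inDef G v c d = nbr G v c ∧ nbr G v d ∧ not (eqb c d) ∧ not (Edge G c d)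

-- |D_G(v)|: unordered pairs counted once, as ordered pairs c < d
defCount : ∀ {n} → Graph n → Fin n → ℕ
defCount {n} G v =
  sum (map (λ c → countFin (λ d → ⌊ c <? d ⌋ ∧ inDef G v c d)) (allFin n))

eliminate : ∀ {n} → Graph n → Fin n → Graph n
eliminate G v = record
  { V = λ u → V G u ∧ not (eqb u v)
  ; A = λ c d → A G c d ∨ (nbr G v c ∧ nbr G v d ∧ not (eqb c d))
  }

fill : ∀ {n} → Graph n → List (Fin n) → ℕ
fill G [] = 0
fill G (v ∷ σ) = defCount G v + fill (eliminate G v) σ

-- σ is a node ordering of G: a bijection {1..|V|} → V, i.e. a list
-- enumerating each vertex of G exactly once
IsOrdering : ∀ {n} → Graph n → List (Fin n) → Set
IsOrdering {n} G σ =
  Unique σ × (∀ v → v ∈ σ → V G v ≡ true) × (∀ v → V G v ≡ true → v ∈ σ)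

IsMinFill : ∀ {n} → Graph n → List (Fin n) → Set
IsMinFill G σ =
  IsOrdering G σ × (∀ σ' → IsOrdering G σ' → fill G σ ≤ fill G σ')

IsCycle : ∀ {n} → Graph n → List (Fin n) → Set
IsCycle G [] = ⊥
IsCycle G (c ∷ cs) =
  Unique (c ∷ cs) × 3 ≤ length (c ∷ cs)
  × Linked (λ a b → Edge G a b ≡ true) (c ∷ cs ++ c ∷ [])

OnCycle : ∀ {n} → Graph n → Fin n → Set
OnCycle G x = Σ (List (Fin _)) λ cs → IsCycle G cs × x ∈ cs

module Submission where

-- Eliminating v deletes its deg(v) edges and adds the |D(v)| fill edges, so along a
-- complete node ordering σ the fill-in telescopes to φ(G, σ) = Σᵢ deg(σ(i)) − |E|, the
-- degrees being taken at elimination time.  It therefore suffices to turn any ordering σ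
-- into one that eliminates x first without increasing this degree sum.  Vertices of σ not
-- adjacent to x commute with x and keep their degrees, so x can move in front of them.  At
-- the first neighbour a of x in σ, deg(x) ≤ 2 ≤ deg(a), because a has a second neighbour on
-- the cycle (which survives the earlier eliminations as a walk avoiding x); and letting x
-- and a trade places in the rest of σ does not increase any later degree, since Γ(x) ∖ {a}
-- is a single vertex, hence a clique.  Finally φ(G, x τ) = |D(x)| + Φ(G_x) is at most the
-- fill-in of the improved ordering, hence of σ.

open import Defs
open import Data.Nat using (ℕ; zero; suc; _+_; _≤_; z≤n; s≤s)
open import Data.Nat.Properties
  using (+-identityʳ; +-comm; +-assoc; +-mono-≤; +-monoʳ-≤; ≤-refl; ≤-reflexive; ≤-trans;
         m≤n+m; +-cancelʳ-≡; +-cancelʳ-≤; module ≤-Reasoning; +-0-commutativeMonoid; +-commutativeSemigroup)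
open import Algebra.Properties.CommutativeSemigroup +-commutativeSemigroup using (x∙yz≈y∙xz)
open import Algebra.Properties.CommutativeMonoid.Sum +-0-commutativeMonoid
  using (sum-syntax; sum-cong-≗; ∑-distrib-+; ∑-comm; sum-replicate-zero)
open import Data.Nat.ListAction using (sum)
open import Data.Bool using (Bool; true; false; _∧_; _∨_; not; if_then_else_; T)
open import Data.Bool.Properties using (T-∧; ∧-zeroʳ; ∧-assoc; ∨-zeroʳ; ∨-identityʳ)
open import Data.Fin using (Fin; _≟_; _<?_) renaming (zero to fzero; suc to fsuc)
open import Data.Fin.Properties using (<-cmp; <-asym; <-irrefl)
open import Relation.Binary.Definitions using (tri<; tri≈; tri>)
open import Data.List using (List; []; _∷_; _++_; map; allFin; tabulate)
open import Data.List.Properties using (map-tabulate; map-id-local; ++-assoc)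
open import Data.List.Relation.Unary.Linked using (Linked; [-]; _∷_)
open import Data.List.Relation.Binary.Permutation.Propositional using (_↭_; ↭⇒↭ₛ)
open import Data.List.Relation.Binary.Permutation.Propositional.Properties using (++-comm; ↭-length)
open import Data.List.Relation.Binary.Permutation.Setoid.Properties using (Unique-resp-↭)
open import Data.List.Membership.Propositional using (_∈_)
open import Data.List.Membership.Propositional.Properties using (∈-map⁻; ∈-map⁺; ∈-∃++)
open import Data.List.Relation.Unary.All as All using (All; []; _∷_)
open import Data.List.Relation.Unary.Any using (here; there)
open import Data.List.Relation.Unary.AllPairs using (_∷_)
open import Data.List.Relation.Unary.Unique.Propositional using (Unique)
import Data.List.Relation.Unary.Unique.Propositional.Properties as Unique
open import Data.Fin.Permutation using (Permutation; _⟨$⟩ʳ_; _⟨$⟩ˡ_; inverseˡ; inverseʳ; transpose)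
open import Data.Product using (Σ; _×_; _,_; proj₁; proj₂)
open import Data.Sum using (_⊎_; inj₁; inj₂; swap)
open import Function using (_∘_; id; Equivalence)
open import Relation.Binary.PropositionalEquality
open import Relation.Nullary using (Dec; yes; no; contradiction)
open import Relation.Nullary.Decidable using (⌊_⌋; ⌊⌋-map′; dec-true; dec-false)

BoolFun : ℕ → Set
BoolFun zero    = Bool
BoolFun (suc k) = Bool → BoolFun k

isTautology : ∀ k → BoolFun k → Bool
isTautology zero    b = b
isTautology (suc k) f = isTautology k (f true) ∧ isTautology k (f false)

Tautology : ∀ k → BoolFun k → Set
Tautology zero    b = b ≡ true
Tautology (suc k) f = ∀ b → Tautology k (f b)

-- Decides an identity in k Boolean variables by evaluating it on all 2^k inputs;
-- the implicit argument is discharged by normalisation.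
truth-table : ∀ k (f : BoolFun k) → {T (isTautology k f)} → Tautology k f
truth-table zero    true          = refl
truth-table zero    false {()}
truth-table (suc k) f     {t} true  = truth-table k (f true)  {proj₁ (Equivalence.to T-∧ t)}
truth-table (suc k) f     {t} false = truth-table k (f false) {proj₂ (Equivalence.to T-∧ t)}

infix  1 _⇔ᵇ_
infixr 0 _⇒ᵇ_

-- Defined by matching, so that a stuck `p ⇔ᵇ q` exposes p and q to unification.
_⇔ᵇ_ : Bool → Bool → Bool
true  ⇔ᵇ b = b
false ⇔ᵇ b = not b

_⇒ᵇ_ : Bool → Bool → Bool
true  ⇒ᵇ b = b
false ⇒ᵇ _ = true

⇔ᵇ⇒≡ : ∀ {a b} → (a ⇔ᵇ b) ≡ true → a ≡ b
⇔ᵇ⇒≡ {true}  {true}  _ = refl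
⇔ᵇ⇒≡ {false} {false} _ = refl

⇒ᵇ-mp : ∀ {a b} → (a ⇒ᵇ b) ≡ true → a ≡ true → b ≡ true
⇒ᵇ-mp {true} a⇒b _ = a⇒b

∧-true⁻ : ∀ {a b} → (a ∧ b) ≡ true → a ≡ true × b ≡ true
∧-true⁻ {true} {true} _ = refl , refl

module _ {A : Set} {R : A → A → Set} where

  Linked-split : ∀ xs {y ys} → Linked R (xs ++ y ∷ ys) → Linked R (xs ++ y ∷ []) × Linked R (y ∷ ys)
  Linked-split []            l       = [-] , l
  Linked-split (_ ∷ [])      (r ∷ l) = r ∷ [-] , l
  Linked-split (_ ∷ x′ ∷ xs) (r ∷ l) with Linked-split (x′ ∷ xs) l
  ... | l₁ , l₂ = r ∷ l₁ , l₂

  Linked-join : ∀ xs {y ys} → Linked R (xs ++ y ∷ []) → Linked R (y ∷ ys) → Linked R (xs ++ y ∷ ys)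
  Linked-join []            _         l₂ = l₂
  Linked-join (_ ∷ [])      (r ∷ [-]) l₂ = r ∷ l₂
  Linked-join (_ ∷ x′ ∷ xs) (r ∷ l₁)  l₂ = r ∷ Linked-join (x′ ∷ xs) l₁ l₂

𝟙 : Bool → ℕ
𝟙 b = if b then 1 else 0

sum-tabulate : ∀ {n} (f : Fin n → ℕ) → sum (tabulate f) ≡ ∑[ i < n ] f i
sum-tabulate {zero}  f = refl
sum-tabulate {suc n} f = cong (f fzero +_) (sum-tabulate (f ∘ fsuc))

∑-mono-≤ : ∀ {n} {f g : Fin n → ℕ} → (∀ i → f i ≤ g i) → ∑[ i < n ] f i ≤ ∑[ i < n ] g i
∑-mono-≤ {zero}  f≤g = z≤n
∑-mono-≤ {suc n} f≤g = +-mono-≤ (f≤g fzero) (∑-mono-≤ (f≤g ∘ fsuc))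

eqb-suc : ∀ {n} (u v : Fin n) → eqb {suc n} (fsuc u) (fsuc v) ≡ eqb u v
eqb-suc u v = ⌊⌋-map′ _ _ (u ≟ v)

∑-pick : ∀ {n} (f : Fin n → ℕ) (v : Fin n) → ∑[ i < n ] (if eqb i v then f i else 0) ≡ f v
∑-pick {suc n} f fzero    = trans (cong (f fzero +_) (sum-replicate-zero n)) (+-identityʳ _)
∑-pick {suc n} f (fsuc v) =
  trans (sum-cong-≗ (λ i → cong (λ b → if b then f (fsuc i) else 0) (eqb-suc i v))) (∑-pick (f ∘ fsuc) v)

∑²-distrib-+ : ∀ {n} (f g : Fin n → Fin n → ℕ) →
  ∑[ c < n ] ∑[ d < n ] (f c d + g c d) ≡ ∑[ c < n ] ∑[ d < n ] f c d + ∑[ c < n ] ∑[ d < n ] g c d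
∑²-distrib-+ {n} f g = trans (sum-cong-≗ (λ c → ∑-distrib-+ (f c) (g c))) (∑-distrib-+ {n} _ _)

𝟙-+-cong : ∀ {a b c d} → (a ∨ b) ≡ (c ∨ d) → (a ∧ b) ≡ (c ∧ d) → 𝟙 a + 𝟙 b ≡ 𝟙 c + 𝟙 d
𝟙-+-cong {a} {b} {c} {d} ∨≡ ∧≡ = begin
  𝟙 a + 𝟙 b             ≡⟨ 𝟙-+ a b ⟩
  𝟙 (a ∨ b) + 𝟙 (a ∧ b) ≡⟨ cong₂ (λ p q → 𝟙 p + 𝟙 q) ∨≡ ∧≡ ⟩
  𝟙 (c ∨ d) + 𝟙 (c ∧ d) ≡⟨ 𝟙-+ c d ⟨
  𝟙 c + 𝟙 d             ∎
  where
  open ≡-Reasoning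
  𝟙-+ : ∀ p q → 𝟙 p + 𝟙 q ≡ 𝟙 (p ∨ q) + 𝟙 (p ∧ q)
  𝟙-+ true  true  = refl
  𝟙-+ true  false = refl
  𝟙-+ false true  = refl
  𝟙-+ false false = refl

𝟙-∧-+ : ∀ l {a b c d} → 𝟙 a + 𝟙 b ≡ 𝟙 c + 𝟙 d → 𝟙 (l ∧ a) + 𝟙 (l ∧ b) ≡ 𝟙 (l ∧ c) + 𝟙 (l ∧ d)
𝟙-∧-+ true  eq = eq
𝟙-∧-+ false _  = refl

𝟙-∧-∨ : ∀ a p q → (p ∧ q ∧ a) ≡ false → 𝟙 (a ∧ (p ∨ q)) ≡ (if p then 𝟙 a else 0) + (if q then 𝟙 a else 0)
𝟙-∧-∨ false p     q     _ = sym (cong₂ _+_ (if-zero p) (if-zero q))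
  where
  if-zero : ∀ b → (if b then 0 else 0) ≡ 0
  if-zero true  = refl
  if-zero false = refl
𝟙-∧-∨ true  true  true  ()
𝟙-∧-∨ true  true  false _ = refl
𝟙-∧-∨ true  false true  _ = refl
𝟙-∧-∨ true  false false _ = refl

module _ {n : ℕ} where

  eqb⇒≡ : {u v : Fin n} → eqb u v ≡ true → u ≡ v
  eqb⇒≡ {u} {v} _ with u ≟ v
  ... | yes u≡v = u≡v

  eqb-refl : (u : Fin n) → eqb u u ≡ true
  eqb-refl u with u ≟ u
  ... | yes _   = refl
  ... | no  u≢u = contradiction refl u≢u

  eqb-≢ : {u v : Fin n} → u ≢ v → eqb u v ≡ false
  eqb-≢ {u} {v} u≢v with u ≟ v
  ... | yes u≡v = contradiction u≡v u≢v
  ... | no  _   = refl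

  eqb-sym : (u v : Fin n) → eqb u v ≡ eqb v u
  eqb-sym u v with v ≟ u
  ... | yes refl = eqb-refl u
  ... | no  v≢u  = eqb-≢ (≢-sym v≢u)

  not-eqb⇒≢ : {u v : Fin n} → not (eqb u v) ≡ true → u ≢ v
  not-eqb⇒≢ {u} u≠v refl = contradiction (trans (sym u≠v) (cong not (eqb-refl u))) λ ()

  countFin-∑ : (p : Fin n → Bool) → countFin p ≡ ∑[ i < n ] 𝟙 (p i)
  countFin-∑ p = trans (cong sum (map-tabulate id (𝟙 ∘ p))) (sum-tabulate (𝟙 ∘ p))

  sum-countFin : (p : Fin n → Fin n → Bool) →
    sum (map (λ c → countFin (p c)) (allFin n)) ≡ ∑[ c < n ] ∑[ d < n ] 𝟙 (p c d)
  sum-countFin p = begin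
    sum (map (λ c → countFin (p c)) (allFin n)) ≡⟨ cong sum (map-tabulate id (λ c → countFin (p c))) ⟩
    sum (tabulate (λ c → countFin (p c)))       ≡⟨ sum-tabulate {n} _ ⟩
    ∑[ c < n ] countFin (p c)                  ≡⟨ sum-cong-≗ (countFin-∑ ∘ p) ⟩
    ∑[ c < n ] ∑[ d < n ] 𝟙 (p c d)             ∎
    where open ≡-Reasoning

  countFin-cong : {p q : Fin n → Bool} → (∀ u → p u ≡ q u) → countFin p ≡ countFin q
  countFin-cong {p} {q} p≗q = begin
    countFin p           ≡⟨ countFin-∑ p ⟩
    ∑[ i < n ] 𝟙 (p i)   ≡⟨ sum-cong-≗ (cong 𝟙 ∘ p≗q) ⟩
    ∑[ i < n ] 𝟙 (q i)   ≡⟨ countFin-∑ q ⟨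
    countFin q           ∎
    where open ≡-Reasoning

  countFin-mono : {p q : Fin n → Bool} → (∀ u → p u ≡ true → q u ≡ true) → countFin p ≤ countFin q
  countFin-mono {p} {q} p⇒q = begin
    countFin p           ≡⟨ countFin-∑ p ⟩
    ∑[ i < n ] 𝟙 (p i)   ≤⟨ ∑-mono-≤ (λ i → 𝟙-mono (p⇒q i)) ⟩
    ∑[ i < n ] 𝟙 (q i)   ≡⟨ countFin-∑ q ⟨
    countFin q           ∎
    where
    open ≤-Reasoning
    𝟙-mono : ∀ {a b} → (a ≡ true → b ≡ true) → 𝟙 a ≤ 𝟙 b
    𝟙-mono {false} a⇒b = z≤n
    𝟙-mono {true}  a⇒b rewrite a⇒b refl = ≤-refl

  countFin-none : {p : Fin n → Bool} → (∀ u → p u ≡ false) → countFin p ≡ 0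
  countFin-none {p} none = trans (countFin-∑ p) (trans (sum-cong-≗ (cong 𝟙 ∘ none)) (sum-replicate-zero n))

  countFin-remove : (p : Fin n → Bool) (v : Fin n) →
    countFin p ≡ countFin (λ u → p u ∧ not (eqb u v)) + 𝟙 (p v)
  countFin-remove p v = begin
    countFin p
      ≡⟨ countFin-∑ p ⟩
    ∑[ i < n ] 𝟙 (p i)
      ≡⟨ sum-cong-≗ (λ i → split (p i) (eqb i v)) ⟩
    ∑[ i < n ] (𝟙 (p i ∧ not (eqb i v)) + (if eqb i v then 𝟙 (p i) else 0))
      ≡⟨ ∑-distrib-+ {n} _ _ ⟩
    ∑[ i < n ] 𝟙 (p i ∧ not (eqb i v)) + ∑[ i < n ] (if eqb i v then 𝟙 (p i) else 0)
      ≡⟨ cong₂ _+_ (sym (countFin-∑ _)) (∑-pick (𝟙 ∘ p) v) ⟩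
    countFin (λ u → p u ∧ not (eqb u v)) + 𝟙 (p v) ∎
    where
    open ≡-Reasoning
    split : ∀ a b → 𝟙 a ≡ 𝟙 (a ∧ not b) + (if b then 𝟙 a else 0)
    split true  true  = refl
    split true  false = refl
    split false true  = refl
    split false false = refl

  𝟙≤countFin : (p : Fin n → Bool) (u : Fin n) → 𝟙 (p u) ≤ countFin p
  𝟙≤countFin p u = subst (𝟙 (p u) ≤_) (sym (countFin-remove p u)) (m≤n+m _ _)

  countFin≡0⇒ : (p : Fin n → Bool) → countFin p ≡ 0 → ∀ u → p u ≡ false
  countFin≡0⇒ p none u with p u in pu
  ... | false = refl
  ... | true with () ← subst₂ (λ b m → 𝟙 b ≤ m) pu none (𝟙≤countFin p u)

  countFin-remove₂ : (p : Fin n → Bool) (a b : Fin n) → countFin p ≡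
    countFin (λ u → (p u ∧ not (eqb u a)) ∧ not (eqb u b)) + 𝟙 (p b ∧ not (eqb b a)) + 𝟙 (p a)
  countFin-remove₂ p a b = trans (countFin-remove p a) (cong (_+ 𝟙 (p a)) (countFin-remove _ b))

  countFin≤2 : (p : Fin n → Bool) (a b : Fin n) → (∀ u → p u ≡ true → u ≡ a ⊎ u ≡ b) → countFin p ≤ 2
  countFin≤2 p a b only = begin
    countFin p
      ≡⟨ countFin-remove₂ p a b ⟩
    countFin (λ u → (p u ∧ not (eqb u a)) ∧ not (eqb u b)) + 𝟙 (p b ∧ not (eqb b a)) + 𝟙 (p a)
      ≡⟨ cong (λ m → m + 𝟙 (p b ∧ not (eqb b a)) + 𝟙 (p a)) (countFin-none others) ⟩
    𝟙 (p b ∧ not (eqb b a)) + 𝟙 (p a)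
      ≤⟨ +-mono-≤ (𝟙≤1 (p b ∧ not (eqb b a))) (𝟙≤1 (p a)) ⟩
    2 ∎
    where
    open ≤-Reasoning
    𝟙≤1 : ∀ c → 𝟙 c ≤ 1
    𝟙≤1 true  = ≤-refl
    𝟙≤1 false = z≤n
    others : ∀ u → ((p u ∧ not (eqb u a)) ∧ not (eqb u b)) ≡ false
    others u with p u in pu
    ... | false = refl
    ... | true with only u pu
    ... | inj₁ refl rewrite eqb-refl u = refl
    ... | inj₂ refl rewrite eqb-refl u = ∧-zeroʳ _

  2≤countFin : (p : Fin n → Bool) {a b : Fin n} → p a ≡ true → p b ≡ true → a ≢ b → 2 ≤ countFin p
  2≤countFin p {a} {b} pa pb a≢b
    rewrite countFin-remove₂ p a b | pa | pb | eqb-≢ (≢-sym a≢b)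
          | +-assoc (countFin (λ u → (p u ∧ not (eqb u a)) ∧ not (eqb u b))) 1 1 = m≤n+m 2 _

  countFin≡2⇒ : (p : Fin n → Bool) {a b : Fin n} → countFin p ≡ 2 → p a ≡ true → p b ≡ true → a ≢ b →
    ∀ u → p u ≡ true → u ≡ a ⊎ u ≡ b
  countFin≡2⇒ p {a} {b} two pa pb a≢b u pu with eqb u a in ua | eqb u b in ub
  ... | true  | _     = inj₁ (eqb⇒≡ ua)
  ... | false | true  = inj₂ (eqb⇒≡ ub)
  ... | false | false = contradiction (trans (sym others) (countFin≡0⇒ q none u)) λ ()
    where
    q : Fin n → Bool
    q w = (p w ∧ not (eqb w a)) ∧ not (eqb w b)
    others : q u ≡ true
    others rewrite pu | ua | ub = refl
    b-only : (p b ∧ not (eqb b a)) ≡ true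
    b-only rewrite pb | eqb-≢ (≢-sym a≢b) = refl
    none : countFin q ≡ 0
    none = +-cancelʳ-≡ 2 _ _ (begin
      countFin q + 2
        ≡⟨ +-assoc (countFin q) 1 1 ⟨
      countFin q + 1 + 1
        ≡⟨ cong₂ (λ c d → countFin q + 𝟙 c + 𝟙 d) b-only pa ⟨
      countFin q + 𝟙 (p b ∧ not (eqb b a)) + 𝟙 (p a)
        ≡⟨ trans (sym (countFin-remove₂ p a b)) two ⟩
      2 ∎)
      where open ≡-Reasoning

-- Elimination

module _ {n : ℕ} where

  Edge-sym : (K : Graph n) → SimpleGraph K → ∀ c d → Edge K c d ≡ Edge K d c
  Edge-sym K (A-sym , _) c d rewrite A-sym c d =
    ⇔ᵇ⇒≡ (truth-table 3 (λ p q e → p ∧ q ∧ e ⇔ᵇ q ∧ p ∧ e) (V K c) (V K d) (A K d c))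

  Edge-irrefl : (K : Graph n) → SimpleGraph K → ∀ c → Edge K c c ≡ false
  Edge-irrefl K (_ , A-irrefl) c rewrite A-irrefl c = trans (cong (V K c ∧_) (∧-zeroʳ _)) (∧-zeroʳ _)

  Edge⇒≢ : (K : Graph n) → SimpleGraph K → {c d : Fin n} → Edge K c d ≡ true → c ≢ d
  Edge⇒≢ K simple {c} c∼d refl = contradiction (trans (sym c∼d) (Edge-irrefl K simple c)) λ ()

  no-loop : (K : Graph n) → SimpleGraph K → ∀ c v → (eqb c v ∧ Edge K v c) ≡ false
  no-loop K simple c v with eqb c v in c=v
  ... | false = refl
  ... | true  = trans (cong (Edge K v) (eqb⇒≡ c=v)) (Edge-irrefl K simple v)

  SimpleGraph-eliminate : (K : Graph n) → SimpleGraph K → ∀ v → SimpleGraph (eliminate K v)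
  SimpleGraph-eliminate K (A-sym , A-irrefl) v = A-sym′ , A-irrefl′
    where
    A-sym′ : ∀ c d → A (eliminate K v) c d ≡ A (eliminate K v) d c
    A-sym′ c d rewrite A-sym c d | eqb-sym c d =
      ⇔ᵇ⇒≡ (truth-table 4 (λ e p q r → e ∨ (p ∧ q ∧ not r) ⇔ᵇ e ∨ (q ∧ p ∧ not r))
              (A K d c) (nbr K v c) (nbr K v d) (eqb d c))
    A-irrefl′ : ∀ c → A (eliminate K v) c c ≡ false
    A-irrefl′ c rewrite A-irrefl c | eqb-refl c = trans (cong (nbr K v c ∧_) (∧-zeroʳ _)) (∧-zeroʳ _)

  Edge-eliminate : (K : Graph n) (v c d : Fin n) → Edge (eliminate K v) c d ≡
    not (eqb c v) ∧ not (eqb d v) ∧ (Edge K c d ∨ (Edge K v c ∧ Edge K v d ∧ not (eqb c d)))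
  Edge-eliminate K v c d = ⇔ᵇ⇒≡ (truth-table 9 (λ vc vd vv acd avc avd cv dv cd →
      (vc ∧ not cv) ∧ (vd ∧ not dv) ∧ (acd ∨ ((vv ∧ vc ∧ avc) ∧ (vv ∧ vd ∧ avd) ∧ not cd))
      ⇔ᵇ not cv ∧ not dv ∧ ((vc ∧ vd ∧ acd) ∨ ((vv ∧ vc ∧ avc) ∧ (vv ∧ vd ∧ avd) ∧ not cd)))
    (V K c) (V K d) (V K v) (A K c d) (A K v c) (A K v d) (eqb c v) (eqb d v) (eqb c d))

  Edge-eliminate⁺ : (K : Graph n) {v c d : Fin n} → c ≢ v → d ≢ v →
    Edge K c d ≡ true ⊎ (Edge K v c ≡ true × Edge K v d ≡ true × c ≢ d) → Edge (eliminate K v) c d ≡ true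
  Edge-eliminate⁺ K {v} {c} {d} c≢v d≢v kept-or-added = trans (Edge-eliminate K v c d)
    (cong₂ _∧_ (cong not (eqb-≢ c≢v)) (cong₂ _∧_ (cong not (eqb-≢ d≢v)) (edge kept-or-added)))
    where
    edge : Edge K c d ≡ true ⊎ (Edge K v c ≡ true × Edge K v d ≡ true × c ≢ d) →
      (Edge K c d ∨ (Edge K v c ∧ Edge K v d ∧ not (eqb c d))) ≡ true
    edge (inj₁ c∼d)               = cong (_∨ (Edge K v c ∧ Edge K v d ∧ not (eqb c d))) c∼d
    edge (inj₂ (v∼c , v∼d , c≢d)) =
      trans (cong (Edge K c d ∨_) (cong₂ _∧_ v∼c (cong₂ _∧_ v∼d (cong not (eqb-≢ c≢d))))) (∨-zeroʳ _)

  Edge-eliminate⁻ : (K : Graph n) {v c d : Fin n} → Edge (eliminate K v) c d ≡ true →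
    c ≢ v × d ≢ v × (Edge K c d ≡ true ⊎ (Edge K v c ≡ true × Edge K v d ≡ true × c ≢ d))
  Edge-eliminate⁻ K {v} {c} {d} c∼d with ∧-true⁻ (trans (sym (Edge-eliminate K v c d)) c∼d)
  ... | c≠v , rest with ∧-true⁻ rest
  ...   | d≠v , kept-or-added = not-eqb⇒≢ c≠v , not-eqb⇒≢ d≠v , edge kept-or-added
    where
    edge : (Edge K c d ∨ (Edge K v c ∧ Edge K v d ∧ not (eqb c d))) ≡ true →
      Edge K c d ≡ true ⊎ (Edge K v c ≡ true × Edge K v d ≡ true × c ≢ d)
    edge h with Edge K c d
    ... | true  = inj₁ refl
    ... | false with ∧-true⁻ h
    ...   | v∼c , h′ with ∧-true⁻ h′
    ...     | v∼d , c≠d = inj₂ (v∼c , v∼d , not-eqb⇒≢ c≠d)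

  infix 4 _≈_
  _≈_ : Graph n → Graph n → Set
  K ≈ L = (∀ u → V K u ≡ V L u) × (∀ c d → Edge K c d ≡ Edge L c d)

  eliminate-cong : {K L : Graph n} (v : Fin n) → K ≈ L → eliminate K v ≈ eliminate L v
  eliminate-cong {K} {L} v (V≡ , E≡) = (λ u → cong (_∧ not (eqb u v)) (V≡ u)) , E≡′
    where
    E≡′ : ∀ c d → Edge (eliminate K v) c d ≡ Edge (eliminate L v) c d
    E≡′ c d rewrite Edge-eliminate K v c d | Edge-eliminate L v c d | E≡ c d | E≡ v c | E≡ v d = refl

  deg-cong : {K L : Graph n} (v : Fin n) → K ≈ L → deg K v ≡ deg L v
  deg-cong v (_ , E≡) = countFin-cong (E≡ v)

  eliminate-comm : {K : Graph n} → SimpleGraph K → ∀ u v →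
    eliminate (eliminate K u) v ≈ eliminate (eliminate K v) u
  eliminate-comm {K} simple u v = V≡ , E≡
    where
    V≡ : ∀ c → V (eliminate (eliminate K u) v) c ≡ V (eliminate (eliminate K v) u) c
    V≡ c = ⇔ᵇ⇒≡ (truth-table 3 (λ p cu cv → (p ∧ not cu) ∧ not cv ⇔ᵇ (p ∧ not cv) ∧ not cu)
                   (V K c) (eqb c u) (eqb c v))
    E≡ : ∀ c d → Edge (eliminate (eliminate K u) v) c d ≡ Edge (eliminate (eliminate K v) u) c d
    E≡ c d = by-cases (u ≟ v)
      where
      by-cases : Dec (u ≡ v) → Edge (eliminate (eliminate K u) v) c d ≡ Edge (eliminate (eliminate K v) u) c d
      by-cases (yes refl) = refl
      by-cases (no u≢v)
          rewrite Edge-eliminate (eliminate K u) v c d | Edge-eliminate K u c d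
                | Edge-eliminate K u v c | Edge-eliminate K u v d
                | Edge-eliminate (eliminate K v) u c d | Edge-eliminate K v c d
                | Edge-eliminate K v u c | Edge-eliminate K v u d | proj₁ simple v u
                | eqb-≢ u≢v | eqb-≢ (≢-sym u≢v)
                | eqb-sym v c | eqb-sym v d | eqb-sym u c | eqb-sym u d =
        ⇔ᵇ⇒≡ (truth-table 13 (λ cv dv cu du cd ecd euc eud evc evd pu pv auv →
          not cv ∧ not dv ∧ ((not cu ∧ not du ∧ (ecd ∨ (euc ∧ eud ∧ not cd)))
             ∨ ((not cu ∧ (evc ∨ ((pu ∧ pv ∧ auv) ∧ euc ∧ not cv)))
                ∧ (not du ∧ (evd ∨ ((pu ∧ pv ∧ auv) ∧ eud ∧ not dv))) ∧ not cd))
          ⇔ᵇ not cu ∧ not du ∧ ((not cv ∧ not dv ∧ (ecd ∨ (evc ∧ evd ∧ not cd)))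
             ∨ ((not cv ∧ (euc ∨ ((pv ∧ pu ∧ auv) ∧ evc ∧ not cu)))
                ∧ (not dv ∧ (eud ∨ ((pv ∧ pu ∧ auv) ∧ evd ∧ not du))) ∧ not cd)))
          (eqb c v) (eqb d v) (eqb c u) (eqb d u) (eqb c d)
          (Edge K c d) (Edge K u c) (Edge K u d) (Edge K v c) (Edge K v d) (V K u) (V K v) (A K u v))

  -- Fill-in and elimination degrees

  degSum : Graph n → List (Fin n) → ℕ
  degSum K []      = 0
  degSum K (v ∷ σ) = deg K v + degSum (eliminate K v) σ

  degSum-cong : {K L : Graph n} (σ : List (Fin n)) → K ≈ L → degSum K σ ≡ degSum L σ
  degSum-cong []      _   = refl
  degSum-cong (v ∷ σ) K≈L = cong₂ _+_ (deg-cong v K≈L) (degSum-cong σ (eliminate-cong v K≈L))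

  edgeCount : Graph n → ℕ
  edgeCount K = sum (map (λ c → countFin (λ d → ⌊ c <? d ⌋ ∧ Edge K c d)) (allFin n))

  𝟙-Edge-ordered : (K : Graph n) → SimpleGraph K → ∀ v u →
    𝟙 (⌊ v <? u ⌋ ∧ Edge K v u) + 𝟙 (⌊ u <? v ⌋ ∧ Edge K u v) ≡ 𝟙 (Edge K v u)
  𝟙-Edge-ordered K simple v u with v <? u | u <? v
  ... | yes v<u | yes u<v = contradiction u<v (<-asym v<u)
  ... | yes _   | no _    = +-identityʳ _
  ... | no _    | yes _   = cong 𝟙 (Edge-sym K simple u v)
  ... | no v≮u  | no u≮v with <-cmp v u
  ...   | tri< v<u _ _  = contradiction v<u v≮u
  ...   | tri≈ _ refl _ = cong 𝟙 (sym (Edge-irrefl K simple v))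
  ...   | tri> _ _ u<v  = contradiction u<v u≮v

  ∑-incident : (K : Graph n) → SimpleGraph K → ∀ v →
    ∑[ c < n ] ∑[ d < n ] 𝟙 (⌊ c <? d ⌋ ∧ Edge K c d ∧ (eqb c v ∨ eqb d v)) ≡ deg K v
  ∑-incident K simple v = begin
    ∑[ c < n ] ∑[ d < n ] 𝟙 (⌊ c <? d ⌋ ∧ Edge K c d ∧ (eqb c v ∨ eqb d v))
      ≡⟨ sum-cong-≗ (λ c → trans (sum-cong-≗ (split c)) (∑-distrib-+ {n} _ _)) ⟩
    ∑[ c < n ] (∑[ d < n ] (if eqb c v then e c d else 0) + ∑[ d < n ] (if eqb d v then e c d else 0))
      ≡⟨ ∑-distrib-+ {n} _ _ ⟩
    ∑[ c < n ] ∑[ d < n ] (if eqb c v then e c d else 0) + ∑[ c < n ] ∑[ d < n ] (if eqb d v then e c d else 0)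
      ≡⟨ cong₂ _+_ (trans (∑-comm {n} {n} _) (sum-cong-≗ (λ d → ∑-pick (λ c → e c d) v)))
                   (sum-cong-≗ (λ c → ∑-pick (e c) v)) ⟩
    ∑[ u < n ] e v u + ∑[ u < n ] e u v
      ≡⟨ ∑-distrib-+ {n} _ _ ⟨
    ∑[ u < n ] (e v u + e u v)
      ≡⟨ sum-cong-≗ (𝟙-Edge-ordered K simple v) ⟩
    ∑[ u < n ] 𝟙 (Edge K v u)
      ≡⟨ countFin-∑ (Edge K v) ⟨
    deg K v ∎
    where
    open ≡-Reasoning
    e : Fin n → Fin n → ℕ
    e c d = 𝟙 (⌊ c <? d ⌋ ∧ Edge K c d)
    split : ∀ c d → 𝟙 (⌊ c <? d ⌋ ∧ Edge K c d ∧ (eqb c v ∨ eqb d v))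
                  ≡ (if eqb c v then e c d else 0) + (if eqb d v then e c d else 0)
    split c d = trans (cong 𝟙 (sym (∧-assoc ⌊ c <? d ⌋ (Edge K c d) _)))
                      (𝟙-∧-∨ (⌊ c <? d ⌋ ∧ Edge K c d) (eqb c v) (eqb d v) not-both)
      where
      not-both : (eqb c v ∧ eqb d v ∧ ⌊ c <? d ⌋ ∧ Edge K c d) ≡ false
      not-both with eqb c v in cv | eqb d v in dv
      ... | false | _     = refl
      ... | true  | false = refl
      ... | true  | true rewrite eqb⇒≡ cv | eqb⇒≡ dv with v <? v
      ...   | yes v<v = contradiction v<v (<-irrefl refl)
      ...   | no  _   = refl

  -- Eliminating v loses the edges at v and gains the missing edges between neighbours of v.
  edges-eliminate : (K : Graph n) → SimpleGraph K → ∀ v c d →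
    𝟙 (Edge (eliminate K v) c d) + 𝟙 (Edge K c d ∧ (eqb c v ∨ eqb d v)) ≡ 𝟙 (Edge K c d) + 𝟙 (inDef K v c d)
  edges-eliminate K simple v c d =
    𝟙-+-cong {Edge (eliminate K v) c d} {Edge K c d ∧ (eqb c v ∨ eqb d v)} {Edge K c d} {inDef K v c d}
             either neither
    where
    either : (Edge (eliminate K v) c d ∨ Edge K c d ∧ (eqb c v ∨ eqb d v)) ≡ (Edge K c d ∨ inDef K v c d)
    either rewrite Edge-eliminate K v c d = ⇔ᵇ⇒≡ (⇒ᵇ-mp (truth-table 6 (λ cv dv cd ecd evc evd →
        not (cv ∧ evc) ∧ not (dv ∧ evd) ⇒ᵇ
          (not cv ∧ not dv ∧ (ecd ∨ (evc ∧ evd ∧ not cd))) ∨ (ecd ∧ (cv ∨ dv))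
          ⇔ᵇ ecd ∨ (evc ∧ evd ∧ not cd ∧ not ecd))
        (eqb c v) (eqb d v) (eqb c d) (Edge K c d) (Edge K v c) (Edge K v d))
      (cong₂ _∧_ (cong not (no-loop K simple c v)) (cong not (no-loop K simple d v))))
    neither : (Edge (eliminate K v) c d ∧ Edge K c d ∧ (eqb c v ∨ eqb d v)) ≡ (Edge K c d ∧ inDef K v c d)
    neither rewrite Edge-eliminate K v c d = ⇔ᵇ⇒≡ (truth-table 6 (λ cv dv cd ecd evc evd →
        (not cv ∧ not dv ∧ (ecd ∨ (evc ∧ evd ∧ not cd))) ∧ (ecd ∧ (cv ∨ dv))
          ⇔ᵇ ecd ∧ (evc ∧ evd ∧ not cd ∧ not ecd))
      (eqb c v) (eqb d v) (eqb c d) (Edge K c d) (Edge K v c) (Edge K v d))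

  edgeCount-eliminate : (K : Graph n) → SimpleGraph K → ∀ v →
    edgeCount (eliminate K v) + deg K v ≡ edgeCount K + defCount K v
  edgeCount-eliminate K simple v = begin
    edgeCount (eliminate K v) + deg K v
      ≡⟨ cong₂ _+_ (sum-countFin (λ c d → ⌊ c <? d ⌋ ∧ Edge (eliminate K v) c d))
                   (sym (∑-incident K simple v)) ⟩
    ∑[ c < n ] ∑[ d < n ] 𝟙 (⌊ c <? d ⌋ ∧ Edge (eliminate K v) c d)
      + ∑[ c < n ] ∑[ d < n ] 𝟙 (⌊ c <? d ⌋ ∧ Edge K c d ∧ (eqb c v ∨ eqb d v))
      ≡⟨ ∑²-distrib-+ {n} _ _ ⟨
    ∑[ c < n ] ∑[ d < n ] (𝟙 (⌊ c <? d ⌋ ∧ Edge (eliminate K v) c d)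
                           + 𝟙 (⌊ c <? d ⌋ ∧ Edge K c d ∧ (eqb c v ∨ eqb d v)))
      ≡⟨ sum-cong-≗ (λ c → sum-cong-≗ (λ d → 𝟙-∧-+ ⌊ c <? d ⌋ (edges-eliminate K simple v c d))) ⟩
    ∑[ c < n ] ∑[ d < n ] (𝟙 (⌊ c <? d ⌋ ∧ Edge K c d) + 𝟙 (⌊ c <? d ⌋ ∧ inDef K v c d))
      ≡⟨ ∑²-distrib-+ {n} _ _ ⟩
    ∑[ c < n ] ∑[ d < n ] 𝟙 (⌊ c <? d ⌋ ∧ Edge K c d)
      + ∑[ c < n ] ∑[ d < n ] 𝟙 (⌊ c <? d ⌋ ∧ inDef K v c d)
      ≡⟨ cong₂ _+_ (sum-countFin (λ c d → ⌊ c <? d ⌋ ∧ Edge K c d))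
                   (sum-countFin (λ c d → ⌊ c <? d ⌋ ∧ inDef K v c d)) ⟨
    edgeCount K + defCount K v ∎
    where open ≡-Reasoning

  edgeCount-empty : (K : Graph n) → (∀ u → V K u ≡ false) → edgeCount K ≡ 0
  edgeCount-empty K none = begin
    edgeCount K
      ≡⟨ sum-countFin (λ c d → ⌊ c <? d ⌋ ∧ Edge K c d) ⟩
    ∑[ c < n ] ∑[ d < n ] 𝟙 (⌊ c <? d ⌋ ∧ Edge K c d)
      ≡⟨ sum-cong-≗ (λ c → trans (sum-cong-≗ (cong 𝟙 ∘ no-edge c)) (sum-replicate-zero n)) ⟩
    ∑[ c < n ] 0
      ≡⟨ sum-replicate-zero n ⟩
    0 ∎
    where
    open ≡-Reasoning
    no-edge : ∀ c d → (⌊ c <? d ⌋ ∧ Edge K c d) ≡ false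
    no-edge c d rewrite none c = ∧-zeroʳ _

  ordering-empty : (K : Graph n) → IsOrdering K [] → ∀ u → V K u ≡ false
  ordering-empty K (_ , _ , covers) u with V K u in Vu
  ... | false = refl
  ... | true with () ← covers u Vu

  ordering-tail : (K : Graph n) {v : Fin n} {σ : List (Fin n)} →
    IsOrdering K (v ∷ σ) → IsOrdering (eliminate K v) σ
  ordering-tail K {v} {σ} (v∉σ ∷ unique , inV , covers) = unique , inV′ , covers′
    where
    inV′ : ∀ u → u ∈ σ → (V K u ∧ not (eqb u v)) ≡ true
    inV′ u u∈σ rewrite inV u (there u∈σ) | eqb-≢ (≢-sym (All.lookup v∉σ u∈σ)) = refl
    covers′ : ∀ u → (V K u ∧ not (eqb u v)) ≡ true → u ∈ σ
    covers′ u Vu∧u≠v with ∧-true⁻ Vu∧u≠v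
    ... | Vu , u≠v with covers u Vu
    ...   | here u≡v  = contradiction u≡v (not-eqb⇒≢ u≠v)
    ...   | there u∈σ = u∈σ

  ordering-cons : (K : Graph n) {v : Fin n} {σ : List (Fin n)} →
    V K v ≡ true → IsOrdering (eliminate K v) σ → IsOrdering K (v ∷ σ)
  ordering-cons K {v} {σ} Vv (unique , inV , covers) = All.tabulate v≢ ∷ unique , inV′ , covers′
    where
    v≢ : ∀ {u} → u ∈ σ → v ≢ u
    v≢ {u} u∈σ = ≢-sym (not-eqb⇒≢ (proj₂ (∧-true⁻ (inV u u∈σ))))
    inV′ : ∀ u → u ∈ v ∷ σ → V K u ≡ true
    inV′ u (here refl)  = Vv
    inV′ u (there u∈σ) = proj₁ (∧-true⁻ (inV u u∈σ))
    covers′ : ∀ u → V K u ≡ true → u ∈ v ∷ σ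
    covers′ u Vu with u ≟ v
    ... | yes refl = here refl
    ... | no  u≢v  = there (covers u (cong₂ _∧_ Vu (cong not (eqb-≢ u≢v))))

  ordering-resp : (K L : Graph n) {σ : List (Fin n)} → (∀ u → V K u ≡ V L u) → IsOrdering K σ → IsOrdering L σ
  ordering-resp K L V≡ (unique , inV , covers) =
    unique , (λ u u∈σ → trans (sym (V≡ u)) (inV u u∈σ)) , (λ u Vu → covers u (trans (V≡ u) Vu))

  ordering-map : (K L : Graph n) {σ : List (Fin n)} (π : Permutation n n) →
    (∀ u → V L (π ⟨$⟩ʳ u) ≡ V K u) → IsOrdering K σ → IsOrdering L (map (π ⟨$⟩ʳ_) σ)
  ordering-map K L {σ} π V≡ (unique , inV , covers) = Unique.map⁺ injective unique , inV′ , covers′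
    where
    injective : ∀ {u w} → π ⟨$⟩ʳ u ≡ π ⟨$⟩ʳ w → u ≡ w
    injective {u} {w} πu≡πw = trans (sym (inverseˡ π)) (trans (cong (π ⟨$⟩ˡ_) πu≡πw) (inverseˡ π))
    inV′ : ∀ u → u ∈ map (π ⟨$⟩ʳ_) σ → V L u ≡ true
    inV′ u u∈πσ with ∈-map⁻ (π ⟨$⟩ʳ_) u∈πσ
    ... | w , w∈σ , refl = trans (V≡ w) (inV w w∈σ)
    covers′ : ∀ u → V L u ≡ true → u ∈ map (π ⟨$⟩ʳ_) σ
    covers′ u Vu = subst (_∈ map (π ⟨$⟩ʳ_) σ) (inverseʳ π)
      (∈-map⁺ (π ⟨$⟩ʳ_) (covers _ (trans (sym (V≡ _)) (trans (cong (V L) (inverseʳ π)) Vu))))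

  fill+edgeCount : (K : Graph n) → SimpleGraph K → (σ : List (Fin n)) → IsOrdering K σ →
    fill K σ + edgeCount K ≡ degSum K σ
  fill+edgeCount K simple []      ordering = edgeCount-empty K (ordering-empty K ordering)
  fill+edgeCount K simple (v ∷ σ) ordering = begin
    defCount K v + fill (eliminate K v) σ + edgeCount K
      ≡⟨ cong (_+ edgeCount K) (+-comm (defCount K v) _) ⟩
    fill (eliminate K v) σ + defCount K v + edgeCount K
      ≡⟨ +-assoc (fill (eliminate K v) σ) _ _ ⟩
    fill (eliminate K v) σ + (defCount K v + edgeCount K)
      ≡⟨ cong (fill (eliminate K v) σ +_)
              (trans (+-comm (defCount K v) _) (sym (edgeCount-eliminate K simple v))) ⟩
    fill (eliminate K v) σ + (edgeCount (eliminate K v) + deg K v)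
      ≡⟨ +-assoc (fill (eliminate K v) σ) _ _ ⟨
    fill (eliminate K v) σ + edgeCount (eliminate K v) + deg K v
      ≡⟨ cong (_+ deg K v) (fill+edgeCount (eliminate K v) (SimpleGraph-eliminate K simple v) σ
                                           (ordering-tail K ordering)) ⟩
    degSum (eliminate K v) σ + deg K v
      ≡⟨ +-comm (degSum (eliminate K v) σ) (deg K v) ⟩
    deg K v + degSum (eliminate K v) σ ∎
    where open ≡-Reasoning

  fill-≤ : (K : Graph n) → SimpleGraph K → {σ σ′ : List (Fin n)} → IsOrdering K σ → IsOrdering K σ′ →
    degSum K σ ≤ degSum K σ′ → fill K σ ≤ fill K σ′
  fill-≤ K simple {σ} {σ′} ordering ordering′ ≤degSum = +-cancelʳ-≤ (edgeCount K) _ _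
    (subst₂ _≤_ (sym (fill+edgeCount K simple σ ordering)) (sym (fill+edgeCount K simple σ′ ordering′)) ≤degSum)

  -- Moving x forward in an ordering

  deg-eliminate-nonadjacent : (K : Graph n) → SimpleGraph K → {x v : Fin n} → Edge K x v ≡ false → v ≢ x →
    deg (eliminate K x) v ≡ deg K v
  deg-eliminate-nonadjacent K simple {x} {v} x≁v v≢x = countFin-cong same
    where
    same : ∀ u → Edge (eliminate K x) v u ≡ Edge K v u
    same u rewrite Edge-eliminate K x v u | x≁v | eqb-≢ v≢x with eqb u x in u=x
    ... | true  = sym (trans (cong (Edge K v) (eqb⇒≡ u=x)) (trans (Edge-sym K simple v x) x≁v))
    ... | false = ∨-identityʳ _

  degSum-postpone : (K : Graph n) → SimpleGraph K → {x v : Fin n} → Edge K x v ≡ false → v ≢ x →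
    ∀ τ → degSum K (x ∷ v ∷ τ) ≡ degSum K (v ∷ x ∷ τ)
  degSum-postpone K simple {x} {v} x≁v v≢x τ = begin
    deg K x + (deg (eliminate K x) v + degSum (eliminate (eliminate K x) v) τ)
      ≡⟨ cong₂ (λ d s → deg K x + (d + s)) (deg-eliminate-nonadjacent K simple x≁v v≢x)
                                           (degSum-cong τ (eliminate-comm simple x v)) ⟩
    deg K x + (deg K v + degSum (eliminate (eliminate K v) x) τ)
      ≡⟨ x∙yz≈y∙xz (deg K x) (deg K v) _ ⟩
    deg K v + (deg K x + degSum (eliminate (eliminate K v) x) τ)
      ≡⟨ cong (λ d → deg K v + (d + degSum (eliminate (eliminate K v) x) τ))
              (deg-eliminate-nonadjacent K simple (trans (Edge-sym K simple v x) x≁v) (≢-sym v≢x)) ⟨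
    deg K v + (deg (eliminate K v) x + degSum (eliminate (eliminate K v) x) τ) ∎
    where open ≡-Reasoning

  deg-eliminate-swap : (K : Graph n) → SimpleGraph K → {x a : Fin n} → Edge K x a ≡ true →
    deg (eliminate K x) a ≡ deg (eliminate K a) x
  deg-eliminate-swap K simple {x} {a} x∼a = countFin-cong same
    where
    same : ∀ u → Edge (eliminate K x) a u ≡ Edge (eliminate K a) x u
    same u rewrite Edge-eliminate K x a u | Edge-eliminate K a x u | Edge-sym K simple a x | x∼a
                 | eqb-sym a x | eqb-≢ (Edge⇒≢ K simple x∼a) | eqb-sym a u | eqb-sym x u =
      ⇔ᵇ⇒≡ (⇒ᵇ-mp (truth-table 4 (λ ua ux au xu →
          not (ua ∧ au) ∧ not (ux ∧ xu) ⇒ᵇ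
            not ux ∧ (au ∨ (xu ∧ not ua)) ⇔ᵇ not ua ∧ (xu ∨ (au ∧ not ux)))
        (eqb u a) (eqb u x) (Edge K a u) (Edge K x u))
        (cong₂ _∧_ (cong not (no-loop K simple u a)) (cong not (no-loop K simple u x))))

  CliqueExcept : Graph n → Fin n → Fin n → Set
  CliqueExcept K x a =
    ∀ {c d} → Edge K x c ≡ true → Edge K x d ≡ true → c ≢ a → d ≢ a → c ≢ d → Edge K c d ≡ true

  CliqueExcept-eliminate : (K : Graph n) → SimpleGraph K → {x a v : Fin n} →
    CliqueExcept K x a → v ≢ x → v ≢ a → CliqueExcept (eliminate K v) x a
  CliqueExcept-eliminate K simple {x} {a} {v} clique v≢x v≢a {c} {d} x∼c x∼d c≢a d≢a c≢d
    with Edge-eliminate⁻ K x∼c | Edge-eliminate⁻ K x∼d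
  ... | _ , c≢v , c-edge | _ , d≢v , d-edge = Edge-eliminate⁺ K c≢v d≢v (edge c-edge d-edge)
    where
    v∼ : ∀ {u} → Edge K v x ≡ true → Edge K x u ≡ true → u ≢ a → u ≢ v → Edge K v u ≡ true
    v∼ v∼x x∼u u≢a u≢v = clique (trans (Edge-sym K simple x v) v∼x) x∼u v≢a u≢a (≢-sym u≢v)
    edge : Edge K x c ≡ true ⊎ (Edge K v x ≡ true × Edge K v c ≡ true × x ≢ c) →
           Edge K x d ≡ true ⊎ (Edge K v x ≡ true × Edge K v d ≡ true × x ≢ d) →
           Edge K c d ≡ true ⊎ (Edge K v c ≡ true × Edge K v d ≡ true × c ≢ d)
    edge (inj₁ x∼c)              (inj₁ x∼d)              = inj₁ (clique x∼c x∼d c≢a d≢a c≢d)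
    edge (inj₁ x∼c)              (inj₂ (v∼x , v∼d , _)) = inj₂ (v∼ v∼x x∼c c≢a c≢v , v∼d , c≢d)
    edge (inj₂ (v∼x , v∼c , _)) (inj₁ x∼d)              = inj₂ (v∼c , v∼ v∼x x∼d d≢a d≢v , c≢d)
    edge (inj₂ (_ , v∼c , _))   (inj₂ (_ , v∼d , _))   = inj₂ (v∼c , v∼d , c≢d)

  deg-eliminate-≤ : (K : Graph n) → SimpleGraph K → {x a v : Fin n} → Edge K x a ≡ true →
    CliqueExcept K x a → v ≢ x → v ≢ a → deg (eliminate K x) v ≤ deg (eliminate K a) v
  deg-eliminate-≤ K simple {x} {a} {v} x∼a clique v≢x v≢a = begin
    deg (eliminate K x) v
      ≡⟨ countFin-remove (Edge (eliminate K x) v) a ⟩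
    countFin (λ u → Edge (eliminate K x) v u ∧ not (eqb u a)) + 𝟙 (Edge (eliminate K x) v a)
      ≤⟨ +-mono-≤ (countFin-mono inherited) (≤-reflexive (cong 𝟙 merged)) ⟩
    countFin (λ u → Edge (eliminate K a) v u ∧ not (eqb u x)) + 𝟙 (Edge (eliminate K a) v x)
      ≡⟨ countFin-remove (Edge (eliminate K a) v) x ⟨
    deg (eliminate K a) v ∎
    where
    open ≤-Reasoning
    inherited : ∀ u → (Edge (eliminate K x) v u ∧ not (eqb u a)) ≡ true →
                      (Edge (eliminate K a) v u ∧ not (eqb u x)) ≡ true
    inherited u v∼u∧u≠a with ∧-true⁻ v∼u∧u≠a
    ... | v∼u , u≠a with Edge-eliminate⁻ K v∼u
    ...   | _ , u≢x , edge =
      cong₂ _∧_ (Edge-eliminate⁺ K v≢a (not-eqb⇒≢ u≠a) (inj₁ (kept edge))) (cong not (eqb-≢ u≢x))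
      where
      kept : Edge K v u ≡ true ⊎ (Edge K x v ≡ true × Edge K x u ≡ true × v ≢ u) → Edge K v u ≡ true
      kept (inj₁ v∼u)               = v∼u
      kept (inj₂ (x∼v , x∼u , v≢u)) = clique x∼v x∼u v≢a (not-eqb⇒≢ u≠a) v≢u
    merged : Edge (eliminate K x) v a ≡ Edge (eliminate K a) v x
    merged rewrite Edge-eliminate K x v a | Edge-eliminate K a v x
                 | Edge-sym K simple v a | Edge-sym K simple v x | Edge-sym K simple a x | x∼a
                 | eqb-≢ v≢x | eqb-≢ v≢a | eqb-≢ (Edge⇒≢ K simple x∼a) | eqb-≢ (≢-sym (Edge⇒≢ K simple x∼a)) =
      ⇔ᵇ⇒≡ (truth-table 2 (λ av xv → av ∨ (xv ∧ true) ⇔ᵇ xv ∨ (av ∧ true)) (Edge K a v) (Edge K x v))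

  transpose-left : (x a : Fin n) → transpose x a ⟨$⟩ʳ x ≡ a
  transpose-left x a rewrite dec-true (x ≟ x) refl = refl

  transpose-other : {x a u : Fin n} → u ≢ x → u ≢ a → transpose x a ⟨$⟩ʳ u ≡ u
  transpose-other {x} {a} {u} u≢x u≢a rewrite dec-false (u ≟ x) u≢x | dec-false (u ≟ a) u≢a = refl

  transpose-right : {x a : Fin n} → a ≢ x → transpose x a ⟨$⟩ʳ a ≡ x
  transpose-right {x} {a} a≢x rewrite dec-false (a ≟ x) a≢x | dec-true (a ≟ a) refl = refl

  degSum-eliminate-swap : (K : Graph n) → SimpleGraph K → {x a : Fin n} → Edge K x a ≡ true → ∀ σ →
    degSum (eliminate K x) (a ∷ σ) ≡ degSum (eliminate K a) (x ∷ σ)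
  degSum-eliminate-swap K simple {x} {a} x∼a σ =
    cong₂ _+_ (deg-eliminate-swap K simple x∼a) (degSum-cong σ (eliminate-comm simple x a))

  -- With x and a trading places, no later degree grows, because Γ(x) ∖ {a} is already a clique.
  degSum-transpose-≤ : (K : Graph n) → SimpleGraph K → {x a : Fin n} → Edge K x a ≡ true → CliqueExcept K x a →
    (σ : List (Fin n)) → Unique σ → All (_≢ a) σ →
    degSum (eliminate K x) (map (transpose x a ⟨$⟩ʳ_) σ) ≤ degSum (eliminate K a) σ
  degSum-transpose-≤ K simple x∼a clique [] _ _ = z≤n
  degSum-transpose-≤ K simple {x} {a} x∼a clique (v ∷ σ) (v∉σ ∷ unique) (v≢a ∷ σ≢a) = by-cases (v ≟ x)
    where
    π : Fin n → Fin n
    π = transpose x a ⟨$⟩ʳ_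
    by-cases : Dec (v ≡ x) → degSum (eliminate K x) (map π (v ∷ σ)) ≤ degSum (eliminate K a) (v ∷ σ)
    by-cases (yes refl) =
      ≤-reflexive (trans (cong (degSum (eliminate K v)) x-to-a) (degSum-eliminate-swap K simple x∼a σ))
      where
      fixed : ∀ {u} → v ≢ u × u ≢ a → π u ≡ u
      fixed (v≢u , u≢a) = transpose-other (≢-sym v≢u) u≢a
      x-to-a : map π (v ∷ σ) ≡ a ∷ σ
      x-to-a = cong₂ _∷_ (transpose-left v a) (map-id-local (All.zipWith fixed (v∉σ , σ≢a)))
    by-cases (no v≢x) = begin
      deg (eliminate K x) (π v) + degSum (eliminate (eliminate K x) (π v)) (map π σ)
        ≡⟨ cong (λ w → deg (eliminate K x) w + degSum (eliminate (eliminate K x) w) (map π σ))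
                (transpose-other v≢x v≢a) ⟩
      deg (eliminate K x) v + degSum (eliminate (eliminate K x) v) (map π σ)
        ≤⟨ +-mono-≤ (deg-eliminate-≤ K simple x∼a clique v≢x v≢a) rest ⟩
      deg (eliminate K a) v + degSum (eliminate (eliminate K a) v) σ ∎
      where
      open ≤-Reasoning
      rest : degSum (eliminate (eliminate K x) v) (map π σ) ≤ degSum (eliminate (eliminate K a) v) σ
      rest = begin
        degSum (eliminate (eliminate K x) v) (map π σ)
          ≡⟨ degSum-cong (map π σ) (eliminate-comm simple x v) ⟩
        degSum (eliminate (eliminate K v) x) (map π σ)
          ≤⟨ degSum-transpose-≤ (eliminate K v) (SimpleGraph-eliminate K simple v)
               (Edge-eliminate⁺ K (≢-sym v≢x) (≢-sym v≢a) (inj₁ x∼a))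
               (CliqueExcept-eliminate K simple clique v≢x v≢a) σ unique σ≢a ⟩
        degSum (eliminate (eliminate K v) a) σ
          ≡⟨ degSum-cong σ (eliminate-comm simple v a) ⟩
        degSum (eliminate (eliminate K a) v) σ ∎

  V-eliminate-transpose : (K : Graph n) {x a : Fin n} → V K x ≡ true → V K a ≡ true → a ≢ x →
    ∀ u → V (eliminate K x) (transpose x a ⟨$⟩ʳ u) ≡ V (eliminate K a) u
  V-eliminate-transpose K {x} {a} Vx Va a≢x u = by-cases (u ≟ x) (u ≟ a)
    where
    by-cases : Dec (u ≡ x) → Dec (u ≡ a) →
      V (eliminate K x) (transpose x a ⟨$⟩ʳ u) ≡ V (eliminate K a) u
    by-cases (yes refl) _
      rewrite transpose-left u a | eqb-≢ a≢x | eqb-≢ (≢-sym a≢x) | Va | Vx = refl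
    by-cases (no u≢x) (yes refl)
      rewrite transpose-right a≢x | eqb-refl x | eqb-refl u = trans (∧-zeroʳ _) (sym (∧-zeroʳ _))
    by-cases (no u≢x) (no u≢a)
      rewrite transpose-other u≢x u≢a | eqb-≢ u≢x | eqb-≢ u≢a = refl

  -- Degree-two vertices on cycles

  data WalkAvoiding (K : Graph n) (x : Fin n) : Fin n → Fin n → Set where
    done : ∀ {u} → WalkAvoiding K x u u
    step : ∀ {u w t} → Edge K u w ≡ true → w ≢ x → WalkAvoiding K x w t → WalkAvoiding K x u t

  WalkAvoiding-snoc : {K : Graph n} {x u w t : Fin n} →
    WalkAvoiding K x u w → Edge K w t ≡ true → t ≢ x → WalkAvoiding K x u t
  WalkAvoiding-snoc done              w∼t t≢x = step w∼t t≢x done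
  WalkAvoiding-snoc (step u∼v v≢x vw) w∼t t≢x = step u∼v v≢x (WalkAvoiding-snoc vw w∼t t≢x)

  WalkAvoiding-reverse : (K : Graph n) → SimpleGraph K → {x u t : Fin n} →
    u ≢ x → WalkAvoiding K x u t → WalkAvoiding K x t u
  WalkAvoiding-reverse K simple u≢x done                         = done
  WalkAvoiding-reverse K simple {u = u} u≢x (step {w = w} u∼w w≢x wt) =
    WalkAvoiding-snoc (WalkAvoiding-reverse K simple w≢x wt) (trans (Edge-sym K simple w u) u∼w) u≢x

  -- Eliminating v shortcuts a walk through v by the fill edge between the neighbours of v on it.
  WalkAvoiding-eliminate : (K : Graph n) → SimpleGraph K → {x v u t : Fin n} →
    WalkAvoiding K x u t → u ≢ v → t ≢ v → WalkAvoiding (eliminate K v) x u t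
  WalkAvoiding-eliminate K simple done _ _ = done
  WalkAvoiding-eliminate K simple {x} {v} {u} (step {w = w} u∼w w≢x wt) u≢v t≢v with w ≟ v
  ... | no w≢v = step (Edge-eliminate⁺ K u≢v w≢v (inj₁ u∼w)) w≢x (WalkAvoiding-eliminate K simple wt w≢v t≢v)
  ... | yes refl with wt
  ...   | done = contradiction refl t≢v
  ...   | step {w = w′} v∼w′ w′≢x w′t with u ≟ w′
  ...     | yes refl = WalkAvoiding-eliminate K simple w′t u≢v t≢v
  ...     | no u≢w′  = step (Edge-eliminate⁺ K u≢v w′≢v (inj₂ (trans (Edge-sym K simple v u) u∼w , v∼w′ , u≢w′)))
                            w′≢x (WalkAvoiding-eliminate K simple w′t w′≢v t≢v)
    where
    w′≢v : w′ ≢ v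
    w′≢v = ≢-sym (Edge⇒≢ K simple v∼w′)

  record Bypassed (K : Graph n) (x a b : Fin n) : Set where
    field
      x∼a  : Edge K x a ≡ true
      x∼b  : Edge K x b ≡ true
      a≢b  : a ≢ b
      only : ∀ u → Edge K x u ≡ true → u ≡ a ⊎ u ≡ b
      walk : WalkAvoiding K x a b

  module _ {K : Graph n} (simple : SimpleGraph K) {x a b : Fin n} (bypass : Bypassed K x a b) where
    open Bypassed bypass

    Bypassed-sym : Bypassed K x b a
    Bypassed-sym = record
      { x∼a  = x∼b
      ; x∼b  = x∼a
      ; a≢b  = ≢-sym a≢b
      ; only = λ u x∼u → swap (only u x∼u)
      ; walk = WalkAvoiding-reverse K simple (≢-sym (Edge⇒≢ K simple x∼a)) walk
      }

    Bypassed-deg≤2 : deg K x ≤ 2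
    Bypassed-deg≤2 = countFin≤2 (Edge K x) a b only

    Bypassed-2≤deg : 2 ≤ deg K a
    Bypassed-2≤deg with walk
    ... | done                  = contradiction refl a≢b
    ... | step a∼w w≢x _        = 2≤countFin (Edge K a) (trans (Edge-sym K simple a x) x∼a) a∼w (≢-sym w≢x)

    Bypassed-clique : CliqueExcept K x a
    Bypassed-clique {c} {d} x∼c x∼d c≢a d≢a c≢d with only c x∼c | only d x∼d
    ... | inj₁ c≡a | _        = contradiction c≡a c≢a
    ... | _        | inj₁ d≡a = contradiction d≡a d≢a
    ... | inj₂ c≡b | inj₂ d≡b = contradiction (trans c≡b (sym d≡b)) c≢d

    Bypassed-eliminate : {v : Fin n} → Edge K x v ≡ false → v ≢ x → Bypassed (eliminate K v) x a b
    Bypassed-eliminate {v} x≁v v≢x = record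
      { x∼a  = Edge-eliminate⁺ K (≢-sym v≢x) (neighbour≢v x∼a) (inj₁ x∼a)
      ; x∼b  = Edge-eliminate⁺ K (≢-sym v≢x) (neighbour≢v x∼b) (inj₁ x∼b)
      ; a≢b  = a≢b
      ; only = only′
      ; walk = WalkAvoiding-eliminate K simple walk (neighbour≢v x∼a) (neighbour≢v x∼b)
      }
      where
      neighbour≢v : ∀ {u} → Edge K x u ≡ true → u ≢ v
      neighbour≢v x∼u refl = contradiction (trans (sym x∼u) x≁v) λ ()
      only′ : ∀ u → Edge (eliminate K v) x u ≡ true → u ≡ a ⊎ u ≡ b
      only′ u x∼u with Edge-eliminate⁻ K x∼u
      ... | _ , _ , inj₁ x∼u′             = only u x∼u′
      ... | _ , _ , inj₂ (v∼x , _ , _)   =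
        contradiction (trans (sym v∼x) (trans (Edge-sym K simple v x) x≁v)) λ ()

  x-first-≤ : (K : Graph n) → SimpleGraph K → {x a b : Fin n} → Bypassed K x a b →
    (σ : List (Fin n)) → IsOrdering K σ →
    Σ (List (Fin n)) λ τ → IsOrdering (eliminate K x) τ × degSum K (x ∷ τ) ≤ degSum K σ
  x-first-≤ K simple {x} bypass [] ordering =
    contradiction (trans (sym (proj₁ (∧-true⁻ (Bypassed.x∼a bypass)))) (ordering-empty K ordering x)) λ ()
  x-first-≤ K simple {x} bypass (v ∷ σ) ordering@(v∉σ ∷ unique , inV , _) = by-cases (v ≟ x)
    where
    Result : Set
    Result = Σ (List (Fin n)) λ τ → IsOrdering (eliminate K x) τ × degSum K (x ∷ τ) ≤ degSum K (v ∷ σ)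
    Vx : V K x ≡ true
    Vx = proj₁ (∧-true⁻ (Bypassed.x∼a bypass))
    Vv : V K v ≡ true
    Vv = inV v (here refl)
    -- v is a or b: let x and v trade places in the rest of σ.
    neighbour-first : v ≢ x → ∀ {w} → Bypassed K x v w → Result
    neighbour-first v≢x bypass′ =
      map (transpose x v ⟨$⟩ʳ_) σ ,
      ordering-map (eliminate K v) (eliminate K x) (transpose x v) (V-eliminate-transpose K Vx Vv v≢x)
                   (ordering-tail K ordering) ,
      +-mono-≤ (≤-trans (Bypassed-deg≤2 simple bypass′) (Bypassed-2≤deg simple bypass′))
               (degSum-transpose-≤ K simple (Bypassed.x∼a bypass′) (Bypassed-clique simple bypass′)
                                   σ unique (All.map ≢-sym v∉σ))
    -- v is not adjacent to x, so x moves before v.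
    postpone : v ≢ x → Edge K x v ≡ false → Result
    postpone v≢x x≁v with x-first-≤ (eliminate K v) (SimpleGraph-eliminate K simple v)
                            (Bypassed-eliminate simple bypass x≁v v≢x) σ (ordering-tail K ordering)
    ... | τ , τ-ordering , ≤σ =
      v ∷ τ ,
      ordering-cons (eliminate K x) (cong₂ _∧_ Vv (cong not (eqb-≢ v≢x)))
        (ordering-resp (eliminate (eliminate K v) x) (eliminate (eliminate K x) v)
           (proj₁ (eliminate-comm simple v x)) τ-ordering) ,
      ≤-trans (≤-reflexive (degSum-postpone K simple x≁v v≢x τ)) (+-monoʳ-≤ (deg K v) ≤σ)
    by-cases : Dec (v ≡ x) → Result
    by-cases (yes refl) = σ , ordering-tail K ordering , ≤-refl
    by-cases (no v≢x) with Edge K x v in x∼v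
    ... | false = postpone v≢x x∼v
    ... | true with Bypassed.only bypass v x∼v
    ...   | inj₁ refl = neighbour-first v≢x bypass
    ...   | inj₂ refl = neighbour-first v≢x (Bypassed-sym simple bypass)

  IsCycle-rotate : {K : Graph n} {x : Fin n} (cs : List (Fin n)) → IsCycle K cs → x ∈ cs →
    Σ (List (Fin n)) λ ws → IsCycle K (x ∷ ws)
  IsCycle-rotate (c ∷ cs) cycle (here refl) = cs , cycle
  IsCycle-rotate {K} {x} (c ∷ cs) (unique , 3≤length , linked) (there x∈cs) with ∈-∃++ x∈cs
  ... | p , q , refl =
    q ++ c ∷ p ,
    Unique-resp-↭ (setoid (Fin n)) (↭⇒↭ₛ rotation) unique ,
    subst (3 ≤_) (↭-length rotation) 3≤length ,
    linked′
    where
    rotation : c ∷ p ++ x ∷ q ↭ x ∷ q ++ c ∷ p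
    rotation = ++-comm (c ∷ p) (x ∷ q)
    linked′ : Linked (λ u w → Edge K u w ≡ true) (x ∷ (q ++ c ∷ p) ++ x ∷ [])
    linked′ with Linked-split (c ∷ p) (subst (λ l → Linked _ (c ∷ l)) (++-assoc p (x ∷ q) (c ∷ [])) linked)
    ... | c⋯x , x⋯c = subst (λ l → Linked _ (x ∷ l)) (sym (++-assoc q (c ∷ p) (x ∷ [])))
                        (Linked-join (x ∷ q) x⋯c c⋯x)

  Linked⇒WalkAvoiding : {K : Graph n} {x u y t : Fin n} {ys : List (Fin n)} →
    Linked (λ c d → Edge K c d ≡ true) (u ∷ y ∷ ys ++ t ∷ []) → All (_≢ x) (y ∷ ys) →
    Σ (Fin n) λ w → w ∈ y ∷ ys × WalkAvoiding K x u w × Edge K w t ≡ true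
  Linked⇒WalkAvoiding {ys = []}    (u∼y ∷ y∼t ∷ [-]) (y≢x ∷ []) = _ , here refl , step u∼y y≢x done , y∼t
  Linked⇒WalkAvoiding {ys = _ ∷ _} (u∼y ∷ rest)      (y≢x ∷ ys≢x) with Linked⇒WalkAvoiding rest ys≢x
  ... | w , w∈ys , walk , w∼t = w , there w∈ys , step u∼y y≢x walk , w∼t

  OnCycle⇒Bypassed : (K : Graph n) → SimpleGraph K → {x : Fin n} → deg K x ≡ 2 → OnCycle K x →
    Σ (Fin n) λ a → Σ (Fin n) λ b → Bypassed K x a b
  OnCycle⇒Bypassed K simple {x} deg≡2 (cs , cycle , x∈cs) with IsCycle-rotate cs cycle x∈cs
  ... | []         , _ , s≤s ()        , _
  ... | _ ∷ []     , _ , s≤s (s≤s ()) , _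
  ... | a ∷ y ∷ ys , (x≢ ∷ (a≢ ∷ _)) , _ , (x∼a ∷ a⋯x)
    with Linked⇒WalkAvoiding a⋯x (All.map ≢-sym (All.tail x≢))
  ...   | b , b∈ , walk , b∼x = a , b , record
    { x∼a  = x∼a
    ; x∼b  = x∼b
    ; a≢b  = All.lookup a≢ b∈
    ; only = countFin≡2⇒ (Edge K x) deg≡2 x∼a x∼b (All.lookup a≢ b∈)
    ; walk = walk
    }
    where
    x∼b : Edge K x b ≡ true
    x∼b = trans (Edge-sym K simple x b) b∼x

corollary10 : ∀ {n} (G : Graph n) → SimpleGraph G
    → (x : Fin n) → V G x ≡ true → deg G x ≡ 2 → OnCycle G x
    → (τ : List (Fin n)) → IsMinFill (eliminate G x) τ
    → IsMinFill G (x ∷ τ)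
corollary10 G simple x Vx deg≡2 on-cycle τ (τ-ordering , τ-minimal) = ordering-cons G Vx τ-ordering , minimal
  where
  minimal : ∀ σ → IsOrdering G σ → fill G (x ∷ τ) ≤ fill G σ
  minimal σ σ-ordering with OnCycle⇒Bypassed G simple deg≡2 on-cycle
  ... | _ , _ , bypass with x-first-≤ G simple bypass σ σ-ordering
  ...   | τ′ , τ′-ordering , x-first≤σ = begin
    fill G (x ∷ τ)  ≤⟨ +-monoʳ-≤ (defCount G x) (τ-minimal τ′ τ′-ordering) ⟩
    fill G (x ∷ τ′) ≤⟨ fill-≤ G simple (ordering-cons G Vx τ′-ordering) σ-ordering x-first≤σ ⟩
    fill G σ        ∎
    where open ≤-Reasoning
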